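{- Let $\Sigma_3=\{0,1,2\}$ with the natural order and let $\psi$ be the morphism on $\Sigma_3^*$ given by $\psi(0)=10$, $\psi(1)=11$, $\psi(2)=12$. If $w\in\Sigma_3^*$ is square-free, then $\psi(w)$ is op-square-free.
   Context: A word is square-free if it contains no factor of the form $uu$ with $u$ nonempty. An order-preserving square is a word $uv$ with $|u|=|v|\ge 1$ and a strictly increasing bijection $f:\mathrm{Alph}(u)\to\mathrm{Alph}(v)$ ($\mathrm{Alph}$ = set of letters occurring) with $v[t]=f(u[t])$ for all $t$. A word is op-square-free if it contains no factor that is an order-preserving square of length greater than $2$. -}

module Defs where

open import Data.Nat using (ℕ; _≤_; _<_)
open import Data.Fin using (Fin; zero; suc; toℕ)
open import Data.List using (List; []; _∷_; _++_; length; map; concatMap)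
open import Data.List.Membership.Propositional using (_∈_)
open import Data.Product using (Σ; ∃; _×_; _,_)
open import Relation.Binary.PropositionalEquality using (_≡_)
open import Relation.Nullary using (¬_)

Σ₃ : Set
Σ₃ = Fin 3

Word : Set
Word = List Σ₃

_<ₗ_ : Σ₃ → Σ₃ → Set
a <ₗ b = toℕ a < toℕ b

Factor : Word → Word → Set
Factor x y = Σ Word λ p → Σ Word λ s → y ≡ p ++ (x ++ s)

SquareFree : Word → Set
SquareFree y = ∀ (u : Word) → 1 ≤ length u → ¬ Factor (u ++ u) y

-- order-preserving square: x = uv, |u| = |v| ≥ 1, and a strictly increasing
-- bijection f : Alph(u) → Alph(v) with v[t] = f(u[t]) for all t.
-- f is given as a function on Σ₃; only its restriction to Alph(u) matters.
OPSquare : Word → Set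
OPSquare x = Σ Word λ u → Σ Word λ v →
  (x ≡ u ++ v) × (length u ≡ length v) × (1 ≤ length u) ×
  (Σ (Σ₃ → Σ₃) λ f →
     (∀ a b → a ∈ u → b ∈ u → a <ₗ b → f a <ₗ f b) ×
     (∀ c → c ∈ v → Σ Σ₃ λ a → (a ∈ u) × (f a ≡ c)) ×
     (v ≡ map f u))

OPSquareFree : Word → Set
OPSquareFree y = ∀ (x : Word) → Factor x y → OPSquare x → length x ≤ 2

ψ₁ : Σ₃ → Word
ψ₁ a = suc zero ∷ a ∷ []

ψ : Word → Word
ψ = concatMap ψ₁

-- ψ w is the sequence of blocks 1a, so every position of ψ w is either a marker (a 1 at an even
-- index) or a letter of w (at an odd index). Let uv be an op-square in ψ w with |u| ≥ 2, with f
-- increasing on Alph(u). If |u| is even, u and v are aligned: some marker of u faces a marker of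
-- v, so f(1) = 1, hence f is the identity on Alph(u) ⊆ {0,1,2}, v = u, and since uu is aligned
-- with the blocks it is the image of a square of w. If |u| is odd (so |u| ≥ 3), the letters at
-- indices 0 and 2 of u are two markers facing two consecutive letters of w in v, or vice versa;
-- either way, since f is a function and injective on Alph(u), those two letters coincide and w
-- contains a square of length 2.
module Submission where

open import Defs
open import Data.Nat using (_≤_; z≤n; s≤s; _≤?_)
open import Data.Nat.Properties using (<-irrefl)
open import Data.Fin using (zero; suc; toℕ)
open import Data.Fin.Properties using (<-cmp)
open import Data.List using ([]; _∷_; _++_; _∷ʳ_; length; map)
open import Data.List.Properties using (∷-injective; ∷-injectiveˡ; ∷-injectiveʳ; ++-assoc; map-id-local)
open import Data.List.Relation.Unary.All using (tabulate)
open import Data.List.Relation.Unary.Any using (here; there)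
open import Data.List.Membership.Propositional using (_∈_)
open import Data.List.Membership.Propositional.Properties using (∈-++⁺ʳ)
open import Data.Product using (Σ; _×_; _,_)
open import Data.Empty using (⊥; ⊥-elim)
open import Relation.Binary.Definitions using (tri<; tri≈; tri>)
open import Relation.Binary.PropositionalEquality using (_≡_; refl; sym; trans; cong; subst)
open import Relation.Nullary using (¬_; yes; no)

one : Σ₃
one = suc zero

two : Σ₃
two = suc (suc zero)

private
  variable
    a b : Σ₃
    p s t u w z : Word
    f : Σ₃ → Σ₃

IncreasingOn : (Σ₃ → Σ₃) → Word → Set
IncreasingOn f u = ∀ a b → a ∈ u → b ∈ u → a <ₗ b → f a <ₗ f b

increasing⇒injective : IncreasingOn f u → a ∈ u → b ∈ u → f a ≡ f b → a ≡ b
increasing⇒injective {a = a} {b = b} inc a∈u b∈u fa≡fb with <-cmp a b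
... | tri< a<b _ _ = ⊥-elim (<-irrefl (cong toℕ fa≡fb) (inc a b a∈u b∈u a<b))
... | tri≈ _ a≡b _ = a≡b
... | tri> _ _ b<a = ⊥-elim (<-irrefl (cong toℕ (sym fa≡fb)) (inc b a b∈u a∈u b<a))

increasing-fixing-one⇒map-id : IncreasingOn f u → one ∈ u → f one ≡ one → map f u ≡ u
increasing-fixing-one⇒map-id {f} {u} inc one∈u f1≡1 = map-id-local (tabulate fixes)
  where
  below-one : ∀ {x} → x <ₗ one → x ≡ zero
  below-one {zero}  _        = refl
  below-one {suc x} (s≤s ())

  above-one : ∀ {x} → one <ₗ x → x ≡ two
  above-one {suc (suc zero)} _ = refl
  above-one {suc zero} (s≤s ())

  fixes : a ∈ u → f a ≡ a
  fixes {zero} 0∈u =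
    below-one (subst (f zero <ₗ_) f1≡1 (inc zero one 0∈u one∈u (s≤s z≤n)))
  fixes {suc zero} _ = f1≡1
  fixes {suc (suc zero)} 2∈u =
    above-one (subst (_<ₗ f two) f1≡1 (inc one two one∈u 2∈u (s≤s (s≤s z≤n))))

squareFree-suffix : ∀ p → SquareFree (p ++ w) → SquareFree w
squareFree-suffix {w} p sf u u≢[] (q , r , w≡) =
  sf u u≢[] (p ++ q , r , trans (cong (p ++_) w≡) (sym (++-assoc p q _)))

¬squareFree-square-prefix : ∀ u → 1 ≤ length u → ¬ SquareFree (u ++ u ++ s)
¬squareFree-square-prefix {s} u u≢[] sf = sf u u≢[] ([] , s , sym (++-assoc u u s))

data BlockCut (w u t : Word) : Set where
  boundary : ∀ z t′ → w ≡ z ++ t′ → u ≡ ψ z → t ≡ ψ t′ → BlockCut w u t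
  inside   : ∀ z a t′ → w ≡ z ++ a ∷ t′ → u ≡ ψ z ∷ʳ one → t ≡ a ∷ ψ t′ → BlockCut w u t

blockCut : ∀ w u t → ψ w ≡ u ++ t → BlockCut w u t
blockCut w       []          t e = boundary [] w refl refl (sym e)
blockCut []      (_ ∷ _)     t ()
blockCut (b ∷ w) (_ ∷ [])    t e with ∷-injective e
... | refl , e′ = inside [] b w refl refl (sym e′)
blockCut (b ∷ w) (_ ∷ _ ∷ u) t e with ∷-injective e
... | refl , e′ with ∷-injective e′
... | refl , e″ with blockCut w u t e″
... | boundary z t′ refl refl t≡ = boundary (b ∷ z) t′ refl refl t≡
... | inside z a t′ refl refl t≡ = inside (b ∷ z) a t′ refl refl t≡

ψ-cancelˡ : ∀ z {s t} → ψ z ++ s ≡ ψ t → Σ Word λ t′ → t ≡ z ++ t′ × s ≡ ψ t′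
ψ-cancelˡ []      e = _ , refl , e
ψ-cancelˡ (b ∷ z) {t = []} ()
ψ-cancelˡ (b ∷ z) {t = c ∷ t} e with ∷-injective (∷-injectiveʳ e)
... | refl , e′ with ψ-cancelˡ z {t = t} e′
... | t′ , refl , s≡ = t′ , refl , s≡

ψ-∷ʳ-one : ∀ z → Σ Word λ r → ψ z ∷ʳ one ≡ one ∷ r
ψ-∷ʳ-one []      = [] , refl
ψ-∷ʳ-one (b ∷ z) = b ∷ (ψ z ∷ʳ one) , refl

head-map-ψ-∷ʳ-one : ∀ f z s → Σ Word λ r → map f (ψ z ∷ʳ one) ++ s ≡ f one ∷ r
head-map-ψ-∷ʳ-one f z s with ψ-∷ʳ-one z
... | r , eq = map f r ++ s , cong (λ x → map f x ++ s) eq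

-- In the next four lemmas u ++ map f u ++ s is ψ (z ++ t) or a ∷ ψ (z ++ t), and u is cut off as in
-- BlockCut: u is ψ z, ψ z ∷ʳ one, a ∷ ψ z or a ∷ (ψ z ∷ʳ one).

even-op-square-at-boundary :
  SquareFree (z ++ t) → map f (ψ z) ++ s ≡ ψ t → 2 ≤ length (ψ z) → IncreasingOn f (ψ z) → ⊥
even-op-square-at-boundary {[]} _ _ () _
even-op-square-at-boundary {b ∷ z} {[]} _ () _ _
even-op-square-at-boundary {b ∷ z} {c ∷ t} {f} {s} sf e _ inc
  with ψ-cancelˡ (b ∷ z) {t = c ∷ t} (trans (cong (_++ s) (sym map-id)) e)
  where
  map-id : map f (ψ (b ∷ z)) ≡ ψ (b ∷ z)
  map-id = increasing-fixing-one⇒map-id inc (here refl) (∷-injectiveˡ e)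
... | _ , refl , _ = ¬squareFree-square-prefix (b ∷ z) (s≤s z≤n) sf

odd-op-square-at-boundary :
  SquareFree (z ++ a ∷ t) → map f (ψ z ∷ʳ one) ++ s ≡ a ∷ ψ t → 2 ≤ length (ψ z ∷ʳ one) → ⊥
odd-op-square-at-boundary {[]} _ _ (s≤s ())
odd-op-square-at-boundary {b ∷ z} {t = []} _ () _
odd-op-square-at-boundary {b ∷ z} {a} {c ∷ t} {f} {s} sf e _ with a≡c
  where
  a≡c : a ≡ c
  a≡c with head-map-ψ-∷ʳ-one f z s
  ... | _ , third = trans (sym (∷-injectiveˡ e))
                          (∷-injectiveˡ (trans (sym third) (∷-injectiveʳ (∷-injectiveʳ e))))
... | refl = ¬squareFree-square-prefix (a ∷ []) (s≤s z≤n) (squareFree-suffix (b ∷ z) sf)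

odd-op-square-inside-block :
  SquareFree (a ∷ z ++ t) → map f (a ∷ ψ z) ++ s ≡ ψ t → 2 ≤ length (a ∷ ψ z) →
  IncreasingOn f (a ∷ ψ z) → ⊥
odd-op-square-inside-block {z = []} _ _ (s≤s ()) _
odd-op-square-inside-block {z = b ∷ z} {[]} _ () _ _
odd-op-square-inside-block {z = b ∷ z} {_ ∷ []} _ () _ _
odd-op-square-inside-block {a} {b ∷ z} {_ ∷ _ ∷ _} sf e _ inc
  with increasing⇒injective inc (here refl) (there (there (here refl)))
         (trans (∷-injectiveˡ e) (sym (∷-injectiveˡ (∷-injectiveʳ (∷-injectiveʳ e)))))
... | refl = ¬squareFree-square-prefix (a ∷ []) (s≤s z≤n) sf

even-op-square-inside-block :
  SquareFree (a ∷ z ++ b ∷ t) → map f (a ∷ (ψ z ∷ʳ one)) ++ s ≡ b ∷ ψ t →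
  IncreasingOn f (a ∷ (ψ z ∷ʳ one)) → ⊥
even-op-square-inside-block {z = z} {t = []} {f} {s} _ e _ with head-map-ψ-∷ʳ-one f z s
... | _ , second with trans (sym second) (∷-injectiveʳ e)
... | ()
even-op-square-inside-block {a} {z} {t = c ∷ t} {f} {s} sf e inc
  with ∷-injective (trans (cong (_++ s) (sym map-id)) e)
  where
  f1≡1 : f one ≡ one
  f1≡1 with head-map-ψ-∷ʳ-one f z s
  ... | _ , second = ∷-injectiveˡ (trans (sym second) (∷-injectiveʳ e))

  map-id : map f (a ∷ (ψ z ∷ʳ one)) ≡ a ∷ (ψ z ∷ʳ one)
  map-id = increasing-fixing-one⇒map-id inc (there (∈-++⁺ʳ (ψ z) (here refl))) f1≡1
... | refl , e′ with ψ-cancelˡ z {t = c ∷ t} (trans (sym (++-assoc (ψ z) (one ∷ []) s)) e′)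
... | _ , t≡ , _ =
  ¬squareFree-square-prefix (a ∷ z) (s≤s z≤n) (subst (λ x → SquareFree (a ∷ z ++ a ∷ x)) t≡ sf)

op-square-at-boundary :
  SquareFree w → u ++ map f u ++ s ≡ ψ w → 2 ≤ length u → IncreasingOn f u → ⊥
op-square-at-boundary {w} {u} {f} {s} sf e long inc with blockCut w u (map f u ++ s) (sym e)
... | boundary z t refl refl e′ = even-op-square-at-boundary {z = z} {t = t} sf e′ long inc
... | inside z _ t refl refl e′ = odd-op-square-at-boundary {z = z} {t = t} sf e′ long

op-square-inside-block :
  SquareFree (a ∷ w) → u ++ map f u ++ s ≡ a ∷ ψ w → 2 ≤ length u → IncreasingOn f u → ⊥
op-square-inside-block {u = []} _ _ () _
op-square-inside-block {a} {w} {_ ∷ u} {f} {s} sf e long inc with ∷-injective e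
... | refl , e′ with blockCut w u (map f (a ∷ u) ++ s) (sym e′)
... | boundary z t refl refl e″ = odd-op-square-inside-block {z = z} {t = t} sf e″ long inc
... | inside z _ t refl refl e″ = even-op-square-inside-block {z = z} {t = t} sf e″ inc

length-short-op-square : ∀ u → ¬ 2 ≤ length u → length (u ++ map f u) ≤ 2
length-short-op-square []          _     = z≤n
length-short-op-square (_ ∷ [])    _     = s≤s (s≤s z≤n)
length-short-op-square (_ ∷ _ ∷ _) short = ⊥-elim (short (s≤s (s≤s z≤n)))

op-square-in-ψ :
  SquareFree w → ψ w ≡ p ++ u ++ map f u ++ s → 2 ≤ length u → IncreasingOn f u → ⊥
op-square-in-ψ {w} {p} sf e long inc with blockCut w p _ e
... | boundary w₁ _ refl refl e′ = op-square-at-boundary (squareFree-suffix w₁ sf) e′ long inc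
... | inside w₁ _ _ refl refl e′ = op-square-inside-block (squareFree-suffix w₁ sf) e′ long inc

lemma30 : (w : Word) → SquareFree w → OPSquareFree (ψ w)
lemma30 w sf _ (p , s , e) (u , _ , refl , _ , _ , f , inc , _ , refl) with 2 ≤? length u
... | no short = length-short-op-square u short
... | yes long =
  ⊥-elim (op-square-in-ψ {p = p} {s = s} sf (trans e (cong (p ++_) (++-assoc u (map f u) s))) long inc)
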